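{- Let $R$ be a proper nonempty subset of $[n]$ and let $T$ be a spanning tree of $Q_n$ that reduces over $R$. If $T'$ is obtained from $T$ by a sequence of edge slides, then $\mathrm{sig}(T'(R,X))=\mathrm{sig}(T(R,X))$ for all $X\subseteq R$.
   Context: $[n]=\{1,\dots,n\}$. $Q_n$: vertices the subsets of $[n]$, edge between $X,Y$ iff $X\oplus Y=\{i\}$ for a single $i$ (the direction). $\sigma_i(X)=X\oplus\{i\}$; for a spanning tree $T$ and edge $e\in T$ in direction $j\ne i$, if $\sigma_i(e)\notin T$ and $T-e+\sigma_i(e)$ is a spanning tree, passing to $T-e+\sigma_i(e)$ is an edge slide. $\mathrm{sig}(T)=(a_1,\dots,a_n)$ with $a_i$ the number of edges of $T$ in direction $i$; $T$ reduces over $R$ if $\sum_{i\in R}a_i=2^{|R|}-1$ (this property is preserved by edge slides since the signature is). For $X\subseteq R$, $Q_n(R,X)$ is the induced subgraph of $Q_n$ on vertices $W$ with $W\cap R=X$, a cube whose edges have directions in $[n]-R$; $T(R,X)$ is the subgraph of $T$ induced on its vertices $W$ with $W\cap R=X$ (a spanning tree of $Q_n(R,X)$ when $T$ reduces over $R$), and its signature records, for each direction $i\in[n]-R$, the number of its edges in direction $i$. -}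

module Defs where

open import Data.Bool using (Bool; true; false; not; if_then_else_)
open import Data.Bool.Properties using () renaming (_≟_ to _≟ᵇ_)
open import Data.Nat using (ℕ; zero; suc; _+_; _∸_; _^_; _≤_)
open import Data.Fin using (Fin; zero; suc)
open import Data.Fin.Subset using (Subset; outside; inside; _∈_; _∉_; _∩_; ∣_∣)
open import Data.Vec using (Vec; []; _∷_; _[_]%=_; _[_]≔_; lookup)
open import Data.Vec.Properties using (≡-dec)
open import Data.List using (List; []; _∷_; _∷ʳ_; map; filter; length; _++_)
open import Data.List.Relation.Unary.Linked using (Linked)
open import Data.List.Relation.Unary.Unique.Propositional using (Unique)
open import Data.Product using (Σ; ∃; _×_; _,_)
open import Relation.Binary.PropositionalEquality using (_≡_; _≢_)
open import Relation.Binary.Construct.Closure.ReflexiveTransitive using (Star)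
open import Relation.Nullary using (¬_; Dec; yes; no)
open import Relation.Unary using (Decidable)
open import Data.Fin.Properties using () renaming (_≟_ to _≟ᶠ_)

-- The hypercube Q_n.  Vertices are subsets of [n] = Fin n, as
-- characteristic vectors (Subset n = Vec Bool n).

flip : ∀ {n} → Fin n → Subset n → Subset n
flip i X = X [ i ]%= not

low : ∀ {n} → Fin n → Subset n → Subset n
low i X = X [ i ]≔ outside

-- A subgraph of Q_n (spanning all vertices) is given by its edge set:
-- G i Y = true (for Y with i ∉ Y) means the direction-i edge
-- {Y, Y ∪ {i}} belongs to G.  (Values at Y with i ∈ Y are ignored:
-- every edge is addressed through its lower endpoint.)
Graph : ℕ → Set
Graph n = Fin n → Subset n → Bool

HasEdge : ∀ {n} → Graph n → Fin n → Subset n → Set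
HasEdge G i X = G i (low i X) ≡ true

hasEdge? : ∀ {n} (G : Graph n) (i : Fin n) → Decidable (HasEdge G i)
hasEdge? G i X = G i (low i X) ≟ᵇ true

Adj : ∀ {n} → Graph n → Subset n → Subset n → Set
Adj G X Y = ∃ λ i → (Y ≡ flip i X) × HasEdge G i X

Connected : ∀ {n} → Graph n → Set
Connected G = ∀ X Y → Star (Adj G) X Y

Cycle : ∀ {n} → Graph n → Set
Cycle {n} G = Σ (Subset n) λ v → Σ (List (Subset n)) λ ws →
  (2 ≤ length ws) × Unique (v ∷ ws) × Linked (Adj G) (v ∷ ws ∷ʳ v)

Acyclic : ∀ {n} → Graph n → Set
Acyclic G = ¬ Cycle G

IsSpanningTree : ∀ {n} → Graph n → Set
IsSpanningTree G = Connected G × Acyclic G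

-- Edge slides.
-- T' is obtained from T by replacing the edge e = {X, X⊕{j}} by
-- σ_i(e) = {X⊕{i}, X⊕{i}⊕{j}} (edge sets otherwise identical).

EdgeSlide : ∀ {n} → Graph n → Graph n → Set
EdgeSlide {n} T T' = Σ (Fin n) λ i → Σ (Fin n) λ j → Σ (Subset n) λ X →
    (i ≢ j)
  × HasEdge T j X
  × ¬ HasEdge T j (flip i X)
  × IsSpanningTree T'
  -- T' = T - e + σ_i(e), described edge by edge:
  × ¬ HasEdge T' j X
  × HasEdge T' j (flip i X)
  × (∀ k Y → ¬ (k ≡ j × low j Y ≡ low j X)
           → ¬ (k ≡ j × low j Y ≡ low j (flip i X))
           → (HasEdge T' k Y → HasEdge T k Y) × (HasEdge T k Y → HasEdge T' k Y))

Slides : ∀ {n} → Graph n → Graph n → Set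
Slides = Star EdgeSlide

allSubsets : ∀ n → List (Subset n)
allSubsets zero = [] ∷ []
allSubsets (suc n) = map (outside ∷_) (allSubsets n) ++ map (inside ∷_) (allSubsets n)

sig : ∀ {n} → Graph n → Fin n → ℕ
sig {n} T i = length (filter P? (allSubsets n))
  where
  P : Subset n → Set
  P W = (lookup W i ≡ outside) × HasEdge T i W
  P? : Decidable P
  P? W with lookup W i ≟ᵇ outside | hasEdge? T i W
  ... | yes p | yes q = yes (p , q)
  ... | no ¬p | _     = no λ { (p , _) → ¬p p }
  ... | yes _ | no ¬q = no λ { (_ , q) → ¬q q }

sumOver : ∀ {n} → Subset n → (Fin n → ℕ) → ℕ
sumOver [] f = 0
sumOver (true ∷ R) f = f zero + sumOver R (λ k → f (suc k))
sumOver (false ∷ R) f = sumOver R (λ k → f (suc k))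

ReducesOver : ∀ {n} → Graph n → Subset n → Set
ReducesOver T R = sumOver R (sig T) ≡ 2 ^ ∣ R ∣ ∸ 1

-- sig(T(R,X)) at a direction i ∉ R: the number of edges of T in direction i
-- with both endpoints W satisfying W ∩ R = X.  (For i ∉ R both endpoints of
-- a direction-i edge have the same trace on R; counted by lower endpoints.)
sigSlice : ∀ {n} → Graph n → Subset n → Subset n → Fin n → ℕ
sigSlice {n} T R X i = length (filter P? (allSubsets n))
  where
  P : Subset n → Set
  P W = (W ∩ R ≡ X) × (lookup W i ≡ outside) × HasEdge T i W
  P? : Decidable P
  P? W with ≡-dec _≟ᵇ_ (W ∩ R) X | lookup W i ≟ᵇ outside | hasEdge? T i W
  ... | yes a | yes p | yes q = yes (a , p , q)
  ... | no ¬a | _     | _     = no λ { (a , _) → ¬a a }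
  ... | yes _ | no ¬p | _     = no λ { (_ , p , _) → ¬p p }
  ... | yes _ | yes _ | no ¬q = no λ { (_ , _ , q) → ¬q q }

module Submission where

-- An edge slide removes an edge e of direction j and adds its translate σ_i(e); it preserves the
-- signature, hence reduction over R, and it can change the slice signatures at a direction outside R
-- only when e and σ_i(e) lie in different slices, i.e. when i ∈ R and j ∉ R.  That case cannot occur.
-- The endpoints of e lie in one slice, and a walk between them inside that slice in T' avoids σ_i(e),
-- so together with e it would close a cycle in T; hence that slice of T' is disconnected.  Colouring
-- every vertex by its slice, except that vertices reachable from one endpoint of e inside the slice
-- get an extra colour, yields 2^|R| + 1 colours, whereas a connected graph with k colours has at least
-- k - 1 bichromatic edges and the only bichromatic edges of T' are its Σ_{i∈R} a_i = 2^|R| - 1 edges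
-- in directions of R.

open import Defs
open import Data.Bool using (not; _∧_)
open import Data.Bool.Properties using (not-involutive; not-¬; ∧-zeroʳ; ∧-identityʳ) renaming (_≟_ to _≟ᵇ_)
open import Data.Fin using (Fin; zero; suc)
open import Data.Fin.Properties using () renaming (_≟_ to _≟ᶠ_)
open import Data.Fin.Subset using (Subset; outside; inside; _∩_; ⊤; ∣_∣; Nonempty; _⊆_; _∉_)
open import Data.List using (List; []; _∷_; _∷ʳ_; _++_; map; filter; length)
open import Data.List.Membership.Propositional using (_∈_)
open import Data.List.Membership.Propositional.Properties
  using (∈-map⁺; ∈-map⁻; ∈-++⁺ˡ; ∈-++⁺ʳ; ∈-++⁻; ∈-filter⁻)
open import Data.List.Properties using (filter-all; filter-≐; filter-none; map-cong-local; length-map; length-++)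
open import Data.List.Relation.Unary.All as All using (All)
open import Data.List.Relation.Unary.All.Properties using (¬Any⇒All¬; ∷ʳ⁻)
open import Data.List.Relation.Unary.Any using (here; there; any?)
open import Data.List.Relation.Unary.Linked as Linked using (Linked; [-]; _∷_)
open import Data.List.Relation.Unary.Unique.Propositional using (Unique; []; _∷_)
import Data.List.Relation.Unary.Unique.Propositional.Properties as Unique
open import Data.Maybe using (Maybe; nothing; just)
open import Data.Maybe.Properties using (just-injective) renaming (≡-dec to ≡-decᵐ)
open import Data.Nat using (ℕ; zero; suc; _+_; _^_; _≤_; _<_; z≤n; s≤s; s≤s⁻¹; z<s)
open import Data.Nat.Induction using (<-wellFounded)
open import Data.Nat.ListAction using (sum)
open import Data.Nat.Properties
  using (+-mono-≤; +-mono-<-≤; +-mono-≤-<; +-assoc; +-comm; +-cancelʳ-≡; +-identityʳ;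
         ≤-trans; ≤-reflexive; <⇒≱; ∸-monoʳ-<; m^n>0; module ≤-Reasoning)
open import Data.Product using (Σ; ∃; ∃₂; _×_; _,_; proj₁; proj₂; map₁; map₂)
open import Data.Sum using (inj₁; inj₂)
open import Data.Unit using (tt)
open import Data.Vec using ([]; _∷_; lookup; _[_]%=_)
open import Data.Vec.Properties
  using (≡-dec; lookup⇒[]=; lookup-replicate; ∷-injectiveˡ; ∷-injectiveʳ;
         lookup∘updateAt; lookup∘updateAt′; updateAt-updateAt; updateAt-id-local; updateAt-cong-local; []≔-idempotent)
open import Function using (_∘_; id; _⇔_; mk⇔; Equivalence)
open import Induction.WellFounded using (Acc; acc)
open import Relation.Binary using (DecidableEquality)
open import Relation.Binary.Construct.Closure.ReflexiveTransitive using (Star; ε; _◅_; _◅◅_)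
import Relation.Binary.Construct.Closure.ReflexiveTransitive as Star
open import Relation.Binary.PropositionalEquality
open import Relation.Nullary using (¬_; Dec; yes; no; contradiction; ¬?; ¬¬-excluded-middle)
open import Relation.Nullary.Decidable using (_×-dec_)
open import Relation.Unary using (Decidable)

private variable
  n : ℕ

lookup-flip : ∀ (i : Fin n) X → lookup (flip i X) i ≡ not (lookup X i)
lookup-flip i X = lookup∘updateAt i X

lookup-flip-≢ : ∀ {i k : Fin n} X → k ≢ i → lookup (flip i X) k ≡ lookup X k
lookup-flip-≢ X k≢i = lookup∘updateAt′ _ _ k≢i X

lookup-low : ∀ (i : Fin n) X → lookup (low i X) i ≡ outside
lookup-low i X = lookup∘updateAt i X

lookup-low-≢ : ∀ {i k : Fin n} X → k ≢ i → lookup (low i X) k ≡ lookup X k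
lookup-low-≢ X k≢i = lookup∘updateAt′ _ _ k≢i X

flip-involutive : ∀ (i : Fin n) X → flip i (flip i X) ≡ X
flip-involutive i X = trans (updateAt-updateAt i X) (updateAt-id-local i X (not-involutive _))

low-flip : ∀ (i : Fin n) X → low i (flip i X) ≡ low i X
low-flip i X = updateAt-updateAt i X

low-idempotent : ∀ (i : Fin n) X → low i (low i X) ≡ low i X
low-idempotent i X = []≔-idempotent X i

low-lower : ∀ (i : Fin n) {X} → lookup X i ≡ outside → low i X ≡ X
low-lower i {X} Xi = updateAt-id-local i X (sym Xi)

low-upper : ∀ (i : Fin n) {X} → lookup X i ≡ inside → low i X ≡ flip i X
low-upper i {X} Xi = updateAt-cong-local i X (cong not (sym Xi))

flip-≢ : ∀ (i : Fin n) X → flip i X ≢ X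
flip-≢ i X eq = not-¬ refl (trans (cong (λ Z → lookup Z i) (sym eq)) (lookup-flip i X))

flip-flip-direction : ∀ {j k : Fin n} X → flip k (flip j X) ≡ X → k ≡ j
flip-flip-direction {j = j} {k} X eq with k ≟ᶠ j
... | yes k≡j = k≡j
... | no k≢j = contradiction
  (trans (cong (λ Z → lookup Z j) (sym eq)) (trans (lookup-flip-≢ (flip j X) (k≢j ∘ sym)) (lookup-flip j X)))
  (not-¬ refl)

low-edge-elim : ∀ (i : Fin n) X (P : Subset n → Subset n → Set) →
  P X (flip i X) → P (flip i X) X → P (low i X) (flip i (low i X))
low-edge-elim i X P p q with lookup X i in Xi
... | outside = subst (λ Y → P Y (flip i Y)) (sym (low-lower i Xi)) p
... | inside  = subst (λ Y → P Y (flip i Y)) (sym (low-upper i Xi))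
                  (subst (P (flip i X)) (sym (flip-involutive i X)) q)

updateAt-∩ : ∀ {k : Fin n} {f} W {R} → lookup R k ≡ outside → (W [ k ]%= f) ∩ R ≡ W ∩ R
updateAt-∩ {k = zero}  {f} (w ∷ W) {outside ∷ R} _ =
  cong (_∷ W ∩ R) (trans (∧-zeroʳ (f w)) (sym (∧-zeroʳ w)))
updateAt-∩ {k = suc k} (w ∷ W) {r ∷ R} Rk = cong (w ∧ r ∷_) (updateAt-∩ W Rk)

∩-lookup : ∀ {i : Fin n} {W V R} → W ∩ R ≡ V ∩ R → lookup R i ≡ inside → lookup W i ≡ lookup V i
∩-lookup {i = zero}  {w ∷ W} {v ∷ V} {inside ∷ R} eq _ =
  trans (sym (∧-identityʳ w)) (trans (∷-injectiveˡ eq) (∧-identityʳ v))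
∩-lookup {i = suc i} {_ ∷ W} {_ ∷ V} {_ ∷ R} eq Ri = ∩-lookup (∷-injectiveʳ eq) Ri

HasEdge-low⁺ : ∀ (G : Graph n) i {X} → HasEdge G i X → HasEdge G i (low i X)
HasEdge-low⁺ G i {X} = trans (cong (G i) (low-idempotent i X))

HasEdge-low⁻ : ∀ (G : Graph n) i {X} → HasEdge G i (low i X) → HasEdge G i X
HasEdge-low⁻ G i {X} = trans (cong (G i) (sym (low-idempotent i X)))

Adj-sym : ∀ (G : Graph n) {X Y} → Adj G X Y → Adj G Y X
Adj-sym G {X} (i , refl , e) = i , sym (flip-involutive i X) , trans (cong (G i) (low-flip i X)) e

Unique-∷ʳ⁻ : ∀ {A : Set} {x : A} xs → Unique (xs ∷ʳ x) → Unique xs × ¬ x ∈ xs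
Unique-∷ʳ⁻ []       _             = [] , λ ()
Unique-∷ʳ⁻ (y ∷ ys) (y∉ys,x ∷ uniq) with Unique-∷ʳ⁻ ys uniq | ∷ʳ⁻ y∉ys,x
... | ys-unique , x∉ys | y∉ys , y≢x =
  y∉ys ∷ ys-unique , λ { (here x≡y) → y≢x (sym x≡y) ; (there x∈ys) → x∉ys x∈ys }

length-filter-≢ : ∀ {A : Set} (_≟_ : DecidableEquality A) c {xs : List A} → Unique xs →
  length xs ≤ suc (length (filter (λ x → ¬? (x ≟ c)) xs))
length-filter-≢ _≟_ c {[]}     _             = z≤n
length-filter-≢ _≟_ c {x ∷ xs} (x∉xs ∷ uniq) with x ≟ c
... | yes refl =
  s≤s (≤-reflexive (sym (cong length (filter-all (λ y → ¬? (y ≟ c)) (All.map (_∘ sym) x∉xs)))))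
... | no _     = s≤s (length-filter-≢ _≟_ c uniq)

indicator : {P : Set} → Dec P → ℕ
indicator (yes _) = 1
indicator (no _)  = 0

indicator-mono : {P Q : Set} (P? : Dec P) (Q? : Dec Q) → (P → Q) → indicator P? ≤ indicator Q?
indicator-mono (yes p) (yes _) _   = s≤s z≤n
indicator-mono (yes p) (no ¬q) P⇒Q = contradiction (P⇒Q p) ¬q
indicator-mono (no _)  _       _   = z≤n

indicator-< : {P Q : Set} (P? : Dec P) (Q? : Dec Q) → ¬ P → Q → indicator P? < indicator Q?
indicator-< (yes p) _       ¬p _ = contradiction p ¬p
indicator-< (no _)  (yes _) _  _ = s≤s z≤n
indicator-< (no _)  (no ¬q) _  q = contradiction q ¬q

indicator-cong : {P Q : Set} (P? : Dec P) (Q? : Dec Q) → P ⇔ Q → indicator P? ≡ indicator Q?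
indicator-cong (yes _) (yes _) _   = refl
indicator-cong (no _)  (no _)  _   = refl
indicator-cong (yes p) (no ¬q) P⇔Q = contradiction (Equivalence.to P⇔Q p) ¬q
indicator-cong (no ¬p) (yes q) P⇔Q = contradiction (Equivalence.from P⇔Q q) ¬p

module _ {A : Set} where

  sum-mono : {g h : A → ℕ} → (∀ x → g x ≤ h x) → ∀ xs → sum (map g xs) ≤ sum (map h xs)
  sum-mono g≤h []       = z≤n
  sum-mono g≤h (x ∷ xs) = +-mono-≤ (g≤h x) (sum-mono g≤h xs)

  sum-mono-< : {g h : A → ℕ} {a : A} {xs : List A} →
    (∀ x → g x ≤ h x) → a ∈ xs → g a < h a → sum (map g xs) < sum (map h xs)
  sum-mono-< g≤h (here {xs = xs} refl) ga<ha = +-mono-<-≤ ga<ha (sum-mono g≤h xs)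
  sum-mono-< g≤h (there a∈xs) ga<ha = +-mono-≤-< (g≤h _) (sum-mono-< g≤h a∈xs ga<ha)

  sum-update : {g h : A → ℕ} {a : A} {xs : List A} → Unique xs → a ∈ xs → (∀ {x} → x ≢ a → g x ≡ h x) →
    sum (map g xs) + h a ≡ sum (map h xs) + g a
  sum-update {g} {h} {a} {_ ∷ xs} (a∉xs ∷ _) (here refl) g≗h = begin
    g a + sum (map g xs) + h a ≡⟨ cong (λ s → g a + s + h a) (cong sum (map-cong-local g≗h-on-xs)) ⟩
    g a + sum (map h xs) + h a ≡⟨ +-assoc (g a) _ (h a) ⟩
    g a + (sum (map h xs) + h a) ≡⟨ +-comm (g a) _ ⟩
    sum (map h xs) + h a + g a ≡⟨ cong (_+ g a) (+-comm _ (h a)) ⟩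
    h a + sum (map h xs) + g a ∎
    where
    open ≡-Reasoning
    g≗h-on-xs : All (λ x → g x ≡ h x) xs
    g≗h-on-xs = All.map (λ a≢x → g≗h (a≢x ∘ sym)) a∉xs
  sum-update {g} {h} {a} {x ∷ xs} (x∉xs ∷ uniq) (there a∈xs) g≗h = begin
    g x + sum (map g xs) + h a ≡⟨ +-assoc (g x) _ (h a) ⟩
    g x + (sum (map g xs) + h a) ≡⟨ cong₂ _+_ (g≗h (All.lookup x∉xs a∈xs)) (sum-update uniq a∈xs g≗h) ⟩
    h x + (sum (map h xs) + g a) ≡⟨ +-assoc (h x) _ (g a) ⟨
    h x + sum (map h xs) + g a ∎
    where open ≡-Reasoning

  sum-swap : DecidableEquality A → {g h : A → ℕ} {a b : A} {xs : List A} →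
    Unique xs → a ∈ xs → b ∈ xs → a ≢ b → (∀ {x} → x ≢ a → x ≢ b → g x ≡ h x) →
    g a ≡ h b → g b ≡ h a → sum (map g xs) ≡ sum (map h xs)
  -- Pass from g to h through g′, which agrees with h at a and with g elsewhere.
  sum-swap _≟_ {g} {h} {a} {b} {xs} uniq a∈xs b∈xs a≢b g≗h ga≡hb gb≡ha =
    +-cancelʳ-≡ (h a) _ _ (begin
    sum (map g xs) + h a  ≡⟨ cong (sum (map g xs) +_) g′a≡ha ⟨
    sum (map g xs) + g′ a ≡⟨ sum-update uniq a∈xs (sym ∘ g′≗g) ⟩
    sum (map g′ xs) + g a ≡⟨ cong (sum (map g′ xs) +_) ga≡hb ⟩
    sum (map g′ xs) + h b ≡⟨ sum-update uniq b∈xs g′≗h ⟩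
    sum (map h xs) + g′ b ≡⟨ cong (sum (map h xs) +_) (trans (g′≗g (a≢b ∘ sym)) gb≡ha) ⟩
    sum (map h xs) + h a  ∎)
    where
    open ≡-Reasoning
    g′ : A → ℕ
    g′ x with x ≟ a
    ... | yes _ = h a
    ... | no _  = g x
    g′a≡ha : g′ a ≡ h a
    g′a≡ha with a ≟ a
    ... | yes _   = refl
    ... | no a≢a = contradiction refl a≢a
    g′≗g : ∀ {x} → x ≢ a → g′ x ≡ g x
    g′≗g {x} x≢a with x ≟ a
    ... | yes x≡a = contradiction x≡a x≢a
    ... | no _    = refl
    g′≗h : ∀ {x} → x ≢ b → g′ x ≡ h x
    g′≗h {x} x≢b with x ≟ a
    ... | yes refl = refl
    ... | no x≢a   = g≗h x≢a x≢b

module _ {A : Set} {P Q : A → Set} (P? : Decidable P) (Q? : Decidable Q) where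

  private
    length-filter≡sum : ∀ {R : A → Set} (R? : Decidable R) xs →
      length (filter R? xs) ≡ sum (map (indicator ∘ R?) xs)
    length-filter≡sum R? []       = refl
    length-filter≡sum R? (x ∷ xs) with R? x
    ... | yes _ = cong suc (length-filter≡sum R? xs)
    ... | no _  = length-filter≡sum R? xs

  length-filter-mono : (∀ {x} → P x → Q x) → ∀ xs → length (filter P? xs) ≤ length (filter Q? xs)
  length-filter-mono P⇒Q xs =
    subst₂ _≤_ (sym (length-filter≡sum P? xs)) (sym (length-filter≡sum Q? xs))
      (sum-mono (λ x → indicator-mono (P? x) (Q? x) P⇒Q) xs)

  length-filter-< : (∀ {x} → P x → Q x) → ∀ {a xs} → a ∈ xs → ¬ P a → Q a →
    length (filter P? xs) < length (filter Q? xs)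
  length-filter-< P⇒Q {a} {xs} a∈xs ¬Pa Qa =
    subst₂ _<_ (sym (length-filter≡sum P? xs)) (sym (length-filter≡sum Q? xs))
      (sum-mono-< (λ x → indicator-mono (P? x) (Q? x) P⇒Q) a∈xs (indicator-< (P? a) (Q? a) ¬Pa Qa))

  length-filter-swap : DecidableEquality A → ∀ {a b xs} → Unique xs → a ∈ xs → b ∈ xs → a ≢ b →
    (∀ {x} → x ≢ a → x ≢ b → P x ⇔ Q x) → P a ⇔ Q b → P b ⇔ Q a →
    length (filter P? xs) ≡ length (filter Q? xs)
  length-filter-swap _≟_ {a} {b} {xs} uniq a∈xs b∈xs a≢b P⇔Q Pa⇔Qb Pb⇔Qa =
    subst₂ _≡_ (sym (length-filter≡sum P? xs)) (sym (length-filter≡sum Q? xs))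
      (sum-swap _≟_ uniq a∈xs b∈xs a≢b
        (λ {x} x≢a x≢b → indicator-cong (P? x) (Q? x) (P⇔Q x≢a x≢b))
        (indicator-cong (P? a) (Q? b) Pa⇔Qb) (indicator-cong (P? b) (Q? a) Pb⇔Qa))

sumOver-cong : ∀ (R : Subset n) {g h : Fin n → ℕ} → (∀ k → g k ≡ h k) → sumOver R g ≡ sumOver R h
sumOver-cong []            g≗h = refl
sumOver-cong (inside ∷ R)  g≗h = cong₂ _+_ (g≗h zero) (sumOver-cong R (g≗h ∘ suc))
sumOver-cong (outside ∷ R) g≗h = sumOver-cong R (g≗h ∘ suc)

sumOver-mono : ∀ (R : Subset n) {g h : Fin n → ℕ} → (∀ k → g k ≤ h k) → sumOver R g ≤ sumOver R h
sumOver-mono []            g≤h = z≤n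
sumOver-mono (inside ∷ R)  g≤h = +-mono-≤ (g≤h zero) (sumOver-mono R (g≤h ∘ suc))
sumOver-mono (outside ∷ R) g≤h = sumOver-mono R (g≤h ∘ suc)

sumOver-< : ∀ (R : Subset n) {g h : Fin n → ℕ} k → lookup R k ≡ inside →
  (∀ k → g k ≤ h k) → g k < h k → sumOver R g < sumOver R h
sumOver-< (inside ∷ R)  zero    _  g≤h gk<hk = +-mono-<-≤ gk<hk (sumOver-mono R (g≤h ∘ suc))
sumOver-< (inside ∷ R)  (suc k) Rk g≤h gk<hk = +-mono-≤-< (g≤h zero) (sumOver-< R k Rk (g≤h ∘ suc) gk<hk)
sumOver-< (outside ∷ R) (suc k) Rk g≤h gk<hk = sumOver-< R k Rk (g≤h ∘ suc) gk<hk

sumOver-⊤ : ∀ (R : Subset n) {g : Fin n → ℕ} → (∀ k → lookup R k ≡ outside → g k ≡ 0) →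
  sumOver ⊤ g ≡ sumOver R g
sumOver-⊤ []            g0 = refl
sumOver-⊤ (inside ∷ R)  g0 = cong (_ +_) (sumOver-⊤ R (g0 ∘ suc))
sumOver-⊤ (outside ∷ R) g0 = cong₂ _+_ (g0 zero refl) (sumOver-⊤ R (g0 ∘ suc))

∈-allSubsets : ∀ (W : Subset n) → W ∈ allSubsets n
∈-allSubsets []            = here refl
∈-allSubsets (outside ∷ W) = ∈-++⁺ˡ (∈-map⁺ (outside ∷_) (∈-allSubsets W))
∈-allSubsets (inside ∷ W)  =
  ∈-++⁺ʳ (map (outside ∷_) (allSubsets _)) (∈-map⁺ (inside ∷_) (∈-allSubsets W))

subsetsOf : Subset n → List (Subset n)
subsetsOf []            = [] ∷ []
subsetsOf (outside ∷ R) = map (outside ∷_) (subsetsOf R)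
subsetsOf (inside ∷ R)  = map (outside ∷_) (subsetsOf R) ++ map (inside ∷_) (subsetsOf R)

allSubsets≡subsetsOf-⊤ : ∀ n → allSubsets n ≡ subsetsOf ⊤
allSubsets≡subsetsOf-⊤ zero    = refl
allSubsets≡subsetsOf-⊤ (suc n) =
  cong (λ Ws → map (outside ∷_) Ws ++ map (inside ∷_) Ws) (allSubsets≡subsetsOf-⊤ n)

subsetsOf-unique : ∀ (R : Subset n) → Unique (subsetsOf R)
subsetsOf-unique []            = All.[] ∷ []
subsetsOf-unique (outside ∷ R) = Unique.map⁺ ∷-injectiveʳ (subsetsOf-unique R)
subsetsOf-unique (inside ∷ R)  =
  Unique.++⁺ (Unique.map⁺ ∷-injectiveʳ (subsetsOf-unique R)) (Unique.map⁺ ∷-injectiveʳ (subsetsOf-unique R))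
             disjoint
  where
  disjoint : ∀ {W} → W ∈ map (outside ∷_) (subsetsOf R) × W ∈ map (inside ∷_) (subsetsOf R) → _
  disjoint (p , q) with ∈-map⁻ (outside ∷_) p | ∈-map⁻ (inside ∷_) q
  ... | _ , _ , refl | _ , _ , ()

allSubsets-unique : ∀ n → Unique (allSubsets n)
allSubsets-unique n = subst Unique (sym (allSubsets≡subsetsOf-⊤ n)) (subsetsOf-unique ⊤)

length-subsetsOf : ∀ (R : Subset n) → length (subsetsOf R) ≡ 2 ^ ∣ R ∣
length-subsetsOf []            = refl
length-subsetsOf (outside ∷ R) = trans (length-map _ (subsetsOf R)) (length-subsetsOf R)
length-subsetsOf (inside ∷ R)  = begin
  length (map (outside ∷_) Ys ++ map (inside ∷_) Ys)       ≡⟨ length-++ (map (outside ∷_) Ys) ⟩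
  length (map (outside ∷_) Ys) + length (map (inside ∷_) Ys) ≡⟨ cong₂ _+_ (length-map _ Ys) (length-map _ Ys) ⟩
  length Ys + length Ys                                      ≡⟨ cong (λ l → l + l) (length-subsetsOf R) ⟩
  2 ^ ∣ R ∣ + 2 ^ ∣ R ∣                                      ≡⟨ cong (2 ^ ∣ R ∣ +_) (+-identityʳ _) ⟨
  2 ^ ∣ R ∣ + (2 ^ ∣ R ∣ + 0)                                ∎
  where
  open ≡-Reasoning
  Ys = subsetsOf R

∈-subsetsOf⁻ : ∀ {R Y : Subset n} → Y ∈ subsetsOf R → Y ∩ R ≡ Y
∈-subsetsOf⁻ {R = []} {[]} _ = refl
∈-subsetsOf⁻ {R = outside ∷ R} Y∈ with ∈-map⁻ (outside ∷_) Y∈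
... | _ , Z∈ , refl = cong (outside ∷_) (∈-subsetsOf⁻ Z∈)
∈-subsetsOf⁻ {R = inside ∷ R} Y∈ with ∈-++⁻ (map (outside ∷_) (subsetsOf R)) Y∈
... | inj₁ Y∈₀ with ∈-map⁻ (outside ∷_) Y∈₀
...   | _ , Z∈ , refl = cong (outside ∷_) (∈-subsetsOf⁻ Z∈)
∈-subsetsOf⁻ {R = inside ∷ R} Y∈ | inj₂ Y∈₁ with ∈-map⁻ (inside ∷_) Y∈₁
...   | _ , Z∈ , refl = cong (inside ∷_) (∈-subsetsOf⁻ Z∈)

-- Walks and paths

walk-crosses : ∀ {V C : Set} {R : V → V → Set} → DecidableEquality C → ∀ (f : V → C) {x y} →
  Star R x y → f x ≢ f y → ∃₂ λ a b → R a b × f a ≢ f b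
walk-crosses _≟_ f ε fx≢fy = contradiction refl fx≢fy
walk-crosses _≟_ f {x} (_◅_ {j = z} xRz walk) fx≢fy with f x ≟ f z
... | yes fx≡fz = walk-crosses _≟_ f walk (fx≢fy ∘ trans fx≡fz)
... | no fx≢fz  = x , z , xRz , fx≢fz

Path : ∀ {V : Set} → (V → V → Set) → V → V → Set
Path R a b = Σ (List _) λ ms → Linked R (a ∷ ms ∷ʳ b) × Unique (a ∷ ms ∷ʳ b)

module _ {V : Set} (_≟_ : DecidableEquality V) {R : V → V → Set} where

  private
    suffix : ∀ {a b ys} → a ∈ ys → Linked R (ys ∷ʳ b) → Unique (ys ∷ʳ b) → Path R a b
    suffix {ys = _ ∷ ms} (here refl) linked uniq       = ms , linked , uniq
    suffix {ys = _ ∷ _}  (there a∈) linked (_ ∷ uniq) = suffix a∈ (Linked.tail linked) uniq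

  walk⇒path : ∀ {a b} → Star R a b → a ≢ b → Path R a b
  walk⇒path ε a≢b = contradiction refl a≢b
  walk⇒path {a} {b} (_◅_ {j = c} aRc walk) a≢b with c ≟ b
  ... | yes refl = [] , aRc ∷ [-] , (a≢b All.∷ All.[]) ∷ All.[] ∷ []
  ... | no c≢b with walk⇒path walk c≢b
  ...   | ms , linked , uniq with any? (a ≟_) (c ∷ ms)
  ...     | yes a∈ = suffix a∈ linked uniq
  ...     | no a∉  = c ∷ ms , aRc ∷ linked , ¬Any⇒All¬ _ a∉path ∷ uniq
    where
    a∉path : ¬ a ∈ c ∷ ms ∷ʳ b
    a∉path a∈ with ∈-++⁻ (c ∷ ms) a∈
    ... | inj₁ a∈cms       = a∉ a∈cms
    ... | inj₂ (here a≡b) = a≢b a≡b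

EdgeAt : Graph n → Fin n → (Subset n → Set) → Subset n → Set
EdgeAt G k A W = A W × lookup W k ≡ outside × HasEdge G k W

edgeAt? : ∀ (G : Graph n) k {A} → Decidable A → Decidable (EdgeAt G k A)
edgeAt? G k A? W = A? W ×-dec lookup W k ≟ᵇ outside ×-dec hasEdge? G k W

edgeCount : Graph n → Fin n → {A : Subset n → Set} → Decidable A → ℕ
edgeCount {n} G k A? = length (filter (edgeAt? G k A?) (allSubsets n))

sig≡edgeCount : ∀ (G : Graph n) k → sig G k ≡ edgeCount G k (λ _ → yes tt)
sig≡edgeCount {n} G k = cong length (filter-≐ _ _ ((tt ,_) , proj₂) (allSubsets n))

sigSlice≡edgeCount : ∀ (G : Graph n) R X k → sigSlice G R X k ≡ edgeCount G k (λ W → ≡-dec _≟ᵇ_ (W ∩ R) X)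
sigSlice≡edgeCount {n} G R X k = cong length (filter-≐ _ _ (id , id) (allSubsets n))

-- The slices T(R, X) of the paper are the subgraphs of outer T R induced on {W ∣ W ∩ R ≡ X}.
outer : Graph n → Subset n → Graph n
outer G R k W = not (lookup R k) ∧ G k W

HasEdge-outer⁻ : ∀ (G : Graph n) R {k W} → HasEdge (outer G R) k W → lookup R k ≡ outside × HasEdge G k W
HasEdge-outer⁻ G R {k} e with lookup R k
... | outside = refl , e
... | inside  = contradiction e λ ()

HasEdge-outer⁺ : ∀ (G : Graph n) R {k W} → lookup R k ≡ outside → HasEdge G k W → HasEdge (outer G R) k W
HasEdge-outer⁺ G R Rk e rewrite Rk = e

Adj-outer⁺ : ∀ (G : Graph n) R {k W} → lookup R k ≡ outside → HasEdge G k W → Adj (outer G R) W (flip k W)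
Adj-outer⁺ G R {k} Rk e = k , refl , HasEdge-outer⁺ G R Rk e

outer-walk-∩ : ∀ (G : Graph n) R {X Y} → Star (Adj (outer G R)) X Y → Y ∩ R ≡ X ∩ R
outer-walk-∩ G R ε = refl
outer-walk-∩ G R ((k , refl , e) ◅ walk) =
  trans (outer-walk-∩ G R walk) (updateAt-∩ _ (proj₁ (HasEdge-outer⁻ G R e)))

-- Colourings of connected subgraphs

module Colouring {n} (G : Graph n) {C : Set} (_≟_ : DecidableEquality C) where

  bichromatic : (Subset n → C) → Fin n → ℕ
  bichromatic f k = edgeCount G k (λ W → ¬? (f W ≟ f (flip k W)))

  bichromaticTotal : (Subset n → C) → ℕ
  bichromaticTotal f = sumOver ⊤ (bichromatic f)

  Used : (Subset n → C) → List C → Set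
  Used f cs = ∀ {c} → c ∈ cs → ∃ λ W → f W ≡ c

  recolour-< : ∀ (f : Subset n → C) (φ : C → C) {a b} → Adj G a b → f a ≢ f b → φ (f a) ≡ φ (f b) →
    bichromaticTotal (φ ∘ f) < bichromaticTotal f
  recolour-< f φ {a} (i , refl , e) fa≢fb φfa≡φfb =
    sumOver-< ⊤ i (lookup-replicate i inside) (λ k → length-filter-mono _ _ fewer (allSubsets n))
      (length-filter-< _ _ fewer (∈-allSubsets W) (λ (≢ , _) → ≢ φ-equal)
                       (f-differ , lookup-low i a , HasEdge-low⁺ G i e))
    where
    fewer : ∀ {k W} → EdgeAt G k (λ W → φ (f W) ≢ φ (f (flip k W))) W →
                      EdgeAt G k (λ W → f W ≢ f (flip k W)) W
    fewer = map₁ (_∘ cong φ)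
    W : Subset n
    W = low i a
    f-differ : f W ≢ f (flip i W)
    f-differ = low-edge-elim i a (λ X Y → f X ≢ f Y) fa≢fb (fa≢fb ∘ sym)
    φ-equal : φ (f W) ≡ φ (f (flip i W))
    φ-equal = low-edge-elim i a (λ X Y → φ (f X) ≡ φ (f Y)) φfa≡φfb (sym φfa≡φfb)

  private
    recolour : C → C → C → C
    recolour old new c with c ≟ old
    ... | yes _ = new
    ... | no _  = c

    recolour-old : ∀ {old new} → recolour old new old ≡ new
    recolour-old {old} with old ≟ old
    ... | yes _       = refl
    ... | no old≢old = contradiction refl old≢old

    recolour-other : ∀ {old new c} → c ≢ old → recolour old new c ≡ c
    recolour-other {old} {c = c} c≢old with c ≟ old
    ... | yes c≡old = contradiction c≡old c≢old
    ... | no _      = refl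

    -- Merging the colour class of b into that of a, across an edge a b, loses one colour and at least
    -- one bichromatic edge.
    bound : Connected G → ∀ f {cs} → Acc _<_ (bichromaticTotal f) → Unique cs → Used f cs →
      length cs ≤ suc (bichromaticTotal f)
    bound conn f {[]}          _        _    _    = z≤n
    bound conn f {_ ∷ []}      _        _    _    = s≤s z≤n
    bound conn f {c₁ ∷ c₂ ∷ cs} (acc rs) uniq@((c₁≢c₂ All.∷ _) ∷ _) used
      with W₁ , refl ← used (here refl) | W₂ , refl ← used (there (here refl))
      with a , b , a~b , fa≢fb ← walk-crosses _≟_ f (conn W₁ W₂) c₁≢c₂ =
      ≤-trans (length-filter-≢ _≟_ (f b) uniq)
              (s≤s (≤-trans (bound conn (φ ∘ f) (rs fewer) (Unique.filter⁺ ≢fb? uniq) used′) fewer))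
      where
      ≢fb? : ∀ c → Dec (c ≢ f b)
      ≢fb? c = ¬? (c ≟ f b)
      φ : C → C
      φ = recolour (f b) (f a)
      fewer : bichromaticTotal (φ ∘ f) < bichromaticTotal f
      fewer = recolour-< f φ a~b fa≢fb (trans (recolour-other fa≢fb) (sym recolour-old))
      used′ : Used (φ ∘ f) (filter ≢fb? (f W₁ ∷ f W₂ ∷ cs))
      used′ c∈ with c∈cs , c≢fb ← ∈-filter⁻ ≢fb? c∈ with W , refl ← used c∈cs =
        W , recolour-other c≢fb

  colours-bound : Connected G → ∀ f {cs} → Unique cs → Used f cs → length cs ≤ suc (bichromaticTotal f)
  colours-bound conn f = bound conn f (<-wellFounded _)

-- Reduction over R makes every slice connected

¬¬-decidable : ∀ n (P : Subset n → Set) → ¬ ¬ (∀ W → Dec (P W))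
¬¬-decidable zero    P k = ¬¬-excluded-middle λ P[]? → k λ { [] → P[]? }
¬¬-decidable (suc n) P k =
  ¬¬-decidable n (P ∘ (outside ∷_)) λ P₀? →
  ¬¬-decidable n (P ∘ (inside ∷_))  λ P₁? →
  k λ { (outside ∷ W) → P₀? W ; (inside ∷ W) → P₁? W }

-- Stated with ¬ ¬ so that reachability may be assumed decidable in the proof.
reduces⇒slice-connected : ∀ (G : Graph n) R → Connected G → ReducesOver G R →
  ∀ {u v} → v ∩ R ≡ u ∩ R → ¬ ¬ Star (Adj (outer G R)) u v
reduces⇒slice-connected {n} G R conn reduces {u} {v} v∼u u↛v =
  ¬¬-decidable n Reachable λ reach? →
    <⇒≱ (∸-monoʳ-< z<s (m^n>0 2 ∣ R ∣)) (subst (2 ^ ∣ R ∣ ≤_) reduces (colour-count reach?))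
  where
  Reachable : Subset n → Set
  Reachable = Star (Adj (outer G R)) u

  colour-count : (∀ W → Dec (Reachable W)) → 2 ^ ∣ R ∣ ≤ sumOver R (sig G)
  colour-count reach? = s≤s⁻¹ (begin
    suc (2 ^ ∣ R ∣)          ≡⟨ cong suc (trans (length-map just (subsetsOf R)) (length-subsetsOf R)) ⟨
    length colours          ≤⟨ colours-bound conn f colours-unique colours-used ⟩
    suc (bichromaticTotal f) ≤⟨ s≤s bichromatic≤sig ⟩
    suc (sumOver R (sig G)) ∎)
    where
    open ≤-Reasoning
    f : Subset n → Maybe (Subset n)
    f W with reach? W
    ... | yes _ = nothing
    ... | no _  = just (W ∩ R)

    open Colouring G (≡-decᵐ (≡-dec _≟ᵇ_))

    f-outer-invariant : ∀ {k W} → lookup R k ≡ outside → HasEdge G k W → f W ≡ f (flip k W)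
    f-outer-invariant {k} {W} Rk e with reach? W | reach? (flip k W)
    ... | yes _      | yes _       = refl
    ... | no _       | no _        = cong just (sym (updateAt-∩ W Rk))
    ... | yes reachW | no ¬reachW′ = contradiction (reachW ◅◅ (Adj-outer⁺ G R Rk e ◅ ε)) ¬reachW′
    ... | no ¬reachW | yes reachW′ = contradiction (reachW′ ◅◅ (Adj-sym (outer G R) (Adj-outer⁺ G R Rk e) ◅ ε)) ¬reachW

    bichromatic≤sig : bichromaticTotal f ≤ sumOver R (sig G)
    bichromatic≤sig = ≤-trans (≤-reflexive (sumOver-⊤ R none-outside)) (sumOver-mono R at-most-sig)
      where
      none-outside : ∀ k → lookup R k ≡ outside → bichromatic f k ≡ 0
      none-outside k Rk = cong length (filter-none _
        (All.universal (λ W (f≢ , _ , e) → f≢ (f-outer-invariant Rk e)) (allSubsets n)))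
      at-most-sig : ∀ k → bichromatic f k ≤ sig G k
      at-most-sig k = ≤-trans (length-filter-mono _ _ (map₁ (λ _ → tt)) (allSubsets n))
                              (≤-reflexive (sym (sig≡edgeCount G k)))

    colours : List (Maybe (Subset n))
    colours = nothing ∷ map just (subsetsOf R)

    colours-unique : Unique colours
    colours-unique = ¬Any⇒All¬ _ nothing∉ ∷ Unique.map⁺ just-injective (subsetsOf-unique R)
      where
      nothing∉ : ¬ nothing ∈ map just (subsetsOf R)
      nothing∉ nothing∈ with ∈-map⁻ just nothing∈
      ... | _ , _ , ()

    colours-used : Used f colours
    colours-used (here refl) = u , f-u
      where
      f-u : f u ≡ nothing
      f-u with reach? u
      ... | yes _    = refl
      ... | no ¬reach = contradiction ε ¬reach
    colours-used (there c∈) with ∈-map⁻ just c∈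
    ... | Y , Y∈ , refl with ≡-dec _≟ᵇ_ Y (u ∩ R)
    ...   | yes refl = v , f-v
      where
      f-v : f v ≡ just (u ∩ R)
      f-v with reach? v
      ... | yes reach = contradiction reach u↛v
      ... | no _      = cong just v∼u
    ...   | no Y≁u = Y , f-Y
      where
      f-Y : f Y ≡ just Y
      f-Y with reach? Y
      ... | yes reach = contradiction (trans (sym (∈-subsetsOf⁻ Y∈)) (outer-walk-∩ G R reach)) Y≁u
      ... | no _      = cong just (∈-subsetsOf⁻ Y∈)

-- Edge slides

module EdgeSlideProperties {n} {T T' : Graph n} where

  shiftOf edgeDirOf : EdgeSlide T T' → Fin n
  shiftOf (i , _) = i
  edgeDirOf (_ , j , _) = j

  removedOf addedOf : EdgeSlide T T' → Subset n
  removedOf (_ , j , X , _) = low j X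
  addedOf (i , j , X , _) = low j (flip i X)

  slide-spanningTree : EdgeSlide T T' → IsSpanningTree T'
  slide-spanningTree (_ , _ , _ , _ , _ , _ , T'-tree , _) = T'-tree

  slide-preserves-edgeCount : ∀ (s : EdgeSlide T T') k {A : Subset n → Set} (A? : Decidable A) →
    (k ≡ edgeDirOf s → A (removedOf s) ⇔ A (addedOf s)) → edgeCount T' k A? ≡ edgeCount T k A?
  slide-preserves-edgeCount (i , j , X , i≢j , e∈T , σe∉T , _ , e∉T' , σe∈T' , agree) k {A} A? A-moves
    with k ≟ᶠ j
  ... | no k≢j =
    cong length (filter-≐ _ _ (map₂ (map₂ (proj₁ (agree-k _))) , map₂ (map₂ (proj₂ (agree-k _)))) (allSubsets n))
    where
    agree-k : ∀ W → (HasEdge T' k W → HasEdge T k W) × (HasEdge T k W → HasEdge T' k W)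
    agree-k W = agree k W (k≢j ∘ proj₁) (k≢j ∘ proj₁)
  ... | yes refl =
    length-filter-swap _ _ (≡-dec _≟ᵇ_) (allSubsets-unique n) (∈-allSubsets a) (∈-allSubsets b) a≢b
                       unchanged-elsewhere neither moved
    where
    a b : Subset n
    a = low k X
    b = low k (flip i X)

    a≢b : a ≢ b
    a≢b a≡b = not-¬ refl (begin
      lookup X i          ≡⟨ lookup-low-≢ X i≢j ⟨
      lookup a i          ≡⟨ cong (λ Z → lookup Z i) a≡b ⟩
      lookup b i          ≡⟨ lookup-low-≢ (flip i X) i≢j ⟩
      lookup (flip i X) i ≡⟨ lookup-flip i X ⟩
      not (lookup X i)    ∎)
      where open ≡-Reasoning

    unchanged-elsewhere : ∀ {W} → W ≢ a → W ≢ b → EdgeAt T' k A W ⇔ EdgeAt T k A W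
    unchanged-elsewhere {W} W≢a W≢b =
      mk⇔ (λ (x , l , e) → x , l , proj₁ (agree-off l) e) (λ (x , l , e) → x , l , proj₂ (agree-off l) e)
      where
      agree-off : lookup W k ≡ outside → (HasEdge T' k W → HasEdge T k W) × (HasEdge T k W → HasEdge T' k W)
      agree-off Wk = agree k W (λ (_ , eq) → W≢a (trans (sym (low-lower k Wk)) eq))
                               (λ (_ , eq) → W≢b (trans (sym (low-lower k Wk)) eq))

    neither : EdgeAt T' k A a ⇔ EdgeAt T k A b
    neither = mk⇔ (λ (_ , _ , e) → contradiction (HasEdge-low⁻ T' k e) e∉T')
                  (λ (_ , _ , e) → contradiction (HasEdge-low⁻ T k e) σe∉T)

    moved : EdgeAt T' k A b ⇔ EdgeAt T k A a
    moved = mk⇔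
      (λ (x , _ , _) → Equivalence.from (A-moves refl) x , lookup-low k X , HasEdge-low⁺ T k e∈T)
      (λ (x , _ , _) → Equivalence.to (A-moves refl) x , lookup-low k (flip i X) , HasEdge-low⁺ T' k σe∈T')

  slide-preserves-sig : EdgeSlide T T' → ∀ k → sig T' k ≡ sig T k
  slide-preserves-sig s k = begin
    sig T' k                      ≡⟨ sig≡edgeCount T' k ⟩
    edgeCount T' k (λ _ → yes tt) ≡⟨ slide-preserves-edgeCount s k (λ _ → yes tt) (λ _ → mk⇔ id id) ⟩
    edgeCount T k (λ _ → yes tt)  ≡⟨ sig≡edgeCount T k ⟨
    sig T k                       ∎
    where open ≡-Reasoning

  slide-preserves-ReducesOver : EdgeSlide T T' → ∀ R → ReducesOver T R → ReducesOver T' R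
  slide-preserves-ReducesOver s R = trans (sumOver-cong R (slide-preserves-sig s))

  slide-preserves-sigSlice : ∀ (s : EdgeSlide T T') R Y {d} → lookup R d ≡ outside →
    (lookup R (edgeDirOf s) ≡ outside → lookup R (shiftOf s) ≡ outside) →
    sigSlice T' R Y d ≡ sigSlice T R Y d
  slide-preserves-sigSlice s@(i , j , X , _) R Y {d} Rd within = begin
    sigSlice T' R Y d    ≡⟨ sigSlice≡edgeCount T' R Y d ⟩
    edgeCount T' d InY?  ≡⟨ slide-preserves-edgeCount s d InY? same-slice ⟩
    edgeCount T d InY?   ≡⟨ sigSlice≡edgeCount T R Y d ⟨
    sigSlice T R Y d     ∎
    where
    open ≡-Reasoning
    InY? : Decidable (λ W → W ∩ R ≡ Y)
    InY? W = ≡-dec _≟ᵇ_ (W ∩ R) Y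
    same-slice : d ≡ j → (low j X ∩ R ≡ Y) ⇔ (low j (flip i X) ∩ R ≡ Y)
    same-slice refl = mk⇔ (trans (sym removed≡added)) (trans removed≡added)
      where
      removed≡added : low j X ∩ R ≡ low j (flip i X) ∩ R
      removed≡added =
        trans (updateAt-∩ X Rd) (sym (trans (updateAt-∩ (flip i X) Rd) (updateAt-∩ X (within Rd))))

  removed-edge-disconnected : ∀ (s : EdgeSlide T T') R → lookup R (shiftOf s) ≡ inside → Acyclic T →
    ¬ Star (Adj (outer T' R)) (removedOf s) (flip (edgeDirOf s) (removedOf s))
  removed-edge-disconnected (i , j , X , i≢j , e∈T , _ , _ , e∉T' , _ , agree) R Ri acyclic walk =
    acyclic (path⇒cycle (walk⇒path (≡-dec _≟ᵇ_)
      (in-slice (outer-walk-∩ T' R walk) (Star.reverse (Adj-sym (outer T' R)) walk)) (flip-≢ j u)))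
    where
    u v : Subset n
    u = low j X
    v = flip j u

    InSliceAdj : Subset n → Subset n → Set
    InSliceAdj x y = Adj (outer T' R) x y × x ∩ R ≡ u ∩ R

    in-slice : ∀ {x} → x ∩ R ≡ u ∩ R → Star (Adj (outer T' R)) x u → Star InSliceAdj x u
    in-slice _   ε             = ε
    in-slice x∼u (step ◅ walk) = (step , x∼u) ◅ in-slice (trans (outer-walk-∩ T' R (step ◅ ε)) x∼u) walk

    -- σ_i(e) lies in another slice since i ∈ R, so only edges common to T and T' stay inside u's slice.
    InSliceAdj⇒Adj-T : ∀ {x y} → InSliceAdj x y → Adj T x y
    InSliceAdj⇒Adj-T {x} ((k , refl , e) , x∼u) = k , refl , proj₁ (agree k x not-removed not-added) e′
      where
      e′ : HasEdge T' k x
      e′ = proj₂ (HasEdge-outer⁻ T' R e)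
      not-removed : ¬ (k ≡ j × low j x ≡ low j X)
      not-removed (refl , eq) = e∉T' (trans (cong (T' j) (sym eq)) e′)
      not-added : ¬ (k ≡ j × low j x ≡ low j (flip i X))
      not-added (refl , eq) = not-¬ refl (begin
        lookup X i                  ≡⟨ lookup-low-≢ X i≢j ⟨
        lookup u i                  ≡⟨ ∩-lookup x∼u Ri ⟨
        lookup x i                  ≡⟨ lookup-low-≢ x i≢j ⟨
        lookup (low j x) i          ≡⟨ cong (λ Z → lookup Z i) eq ⟩
        lookup (low j (flip i X)) i ≡⟨ lookup-low-≢ (flip i X) i≢j ⟩
        lookup (flip i X) i         ≡⟨ lookup-flip i X ⟩
        not (lookup X i)            ∎)
        where open ≡-Reasoning

    path⇒cycle : Path InSliceAdj v u → Cycle T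
    path⇒cycle ([] , ((k , u≡ , e) , _) ∷ [-] , _) with flip-flip-direction u (sym u≡)
    ... | refl = contradiction (trans (cong (T' j) (sym low-v≡u)) (proj₂ (HasEdge-outer⁻ T' R e))) e∉T'
      where
      low-v≡u : low j v ≡ low j X
      low-v≡u = trans (low-flip j u) (low-idempotent j X)
    path⇒cycle (m ∷ ms , linked , uniq) with Unique-∷ʳ⁻ (v ∷ m ∷ ms) uniq
    ... | vms-unique , u∉vms =
      u , v ∷ m ∷ ms , s≤s (s≤s z≤n) , ¬Any⇒All¬ _ u∉vms ∷ vms-unique ,
      (j , refl , HasEdge-low⁺ T j e∈T) ∷ Linked.map InSliceAdj⇒Adj-T linked

  slide-within-slices : ∀ (s : EdgeSlide T T') R → Acyclic T → ReducesOver T' R →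
    lookup R (edgeDirOf s) ≡ outside → lookup R (shiftOf s) ≡ outside
  slide-within-slices s@(i , j , X , _ , _ , _ , (T'-connected , _) , _) R acyclic reduces Rj
    with lookup R i in Ri
  ... | outside = refl
  ... | inside  = contradiction (removed-edge-disconnected s R Ri acyclic)
                    (reduces⇒slice-connected T' R T'-connected reduces (updateAt-∩ (low j X) Rj))

∉⇒lookup≡outside : ∀ {i : Fin n} {R} → i ∉ R → lookup R i ≡ outside
∉⇒lookup≡outside {i = i} {R} i∉R with lookup R i in Ri
... | outside = refl
... | inside  = contradiction (lookup⇒[]= i R Ri) i∉R

corollary6p14 : ∀ {n} (R : Subset n) → Nonempty R → (∃ λ k → k ∉ R)
    → (T T' : Graph n) → IsSpanningTree T → ReducesOver T R → Slides T T'
    → ∀ (X : Subset n) → X ⊆ R → ∀ (i : Fin n) → i ∉ R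
    → sigSlice T' R X i ≡ sigSlice T R X i
corollary6p14 R _ _ T T' T-tree T-reduces slides X _ d d∉R = go T-tree T-reduces slides
  where
  go : ∀ {T T'} → IsSpanningTree T → ReducesOver T R → Slides T T' → sigSlice T' R X d ≡ sigSlice T R X d
  go _      _         ε            = refl
  go {T} T-tree T-reduces (_◅_ {j = T₁} s slides) =
    trans (go (slide-spanningTree s) T₁-reduces slides)
          (slide-preserves-sigSlice s R X (∉⇒lookup≡outside d∉R)
                                    (slide-within-slices s R (proj₂ T-tree) T₁-reduces))
    where
    open EdgeSlideProperties {T = T} {T' = T₁}
    T₁-reduces : ReducesOver T₁ R
    T₁-reduces = slide-preserves-ReducesOver s R T-reduces
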